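{- For any graph $G=(V,E)$ and any partition $\Gamma$ of $E$ into nonempty groups, with edge utilities, $\mathrm{MP}(G)-\mathrm{DF\text{ - }MP}(G,\Gamma)\le 1/2$. Moreover, for every $\varepsilon>0$ there exist a graph $G$ and an edge partition $\Gamma$ with $\mathrm{MP}(G)-\mathrm{DF\text{ - }MP}(G,\Gamma)>\frac12-\varepsilon$.
   Context: Max-Cut with edge utilities: $G=(V,E)$ is a finite simple graph and $\Gamma=\{E_1,\ldots,E_\gamma\}$ is a partition of $E$ into nonempty groups. A cut is a subset $S\subseteq V$; for an edge $e$, $X_e(S)=1$ if $e$ has exactly one endpoint in $S$ and $0$ otherwise. For $F\subseteq E$, $f_S(F)=\sum_{e\in F}X_e(S)$. Define $\mathrm{MP}(G)=\max_{S\subseteq V}f_S(E)/|E|$ and $\mathrm{DF\text{ - }MP}(G,\Gamma)=\max_{D}\min_{i\in[\gamma]}\mathbb{E}_{S\sim D}f_S(E_i)/|E_i|$, where the outer maximum is over all probability distributions $D$ on the subsets of $V$.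
   Formalization: The probability distributions D on the subsets of V are taken with rational weights, and ε ranges over the positive rationals. -}

module Defs where

open import Data.Bool using (Bool; true; false; if_then_else_; _xor_)
open import Data.Nat as ℕ using (ℕ; zero; suc)
open import Data.Fin using (Fin; toℕ; _≟_)
open import Data.Bool using (_∧_)
open import Data.Fin.Properties using ()
open import Data.List using (List; []; _∷_; map; foldr; tabulate; _++_)
open import Data.List.Relation.Unary.All using (All)
open import Data.Product using (_×_; _,_; proj₁; proj₂; ∃)
open import Data.Integer using (+_)
open import Data.Rational using (ℚ; _/_; 0ℚ; 1ℚ; _+_; _*_; _≤_; _⊔_)
open import Relation.Binary.PropositionalEquality using (_≡_)
open import Relation.Nullary.Decidable using (does)
open import Function.Definitions using (Injective)

-- Each edge is an ordered pair (u , v) with u < v (so no loops, and each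
-- unordered pair has a canonical form); injectivity of `edge` rules out
-- multi-edges.
record Graph : Set where
  field
    n      : ℕ
    m      : ℕ
    edge   : Fin m → Fin n × Fin n
    noLoop : ∀ e → toℕ (proj₁ (edge e)) ℕ.< toℕ (proj₂ (edge e))
    simple : Injective _≡_ _≡_ edge
open Graph public

record EdgePartition (G : Graph) : Set where
  field
    γ        : ℕ
    group    : Fin (m G) → Fin γ
    nonempty : ∀ (i : Fin γ) → ∃ λ e → group e ≡ i
open EdgePartition public

Cut : ℕ → Set
Cut n = Fin n → Bool

allCuts : (n : ℕ) → List (Cut n)
allCuts zero = (λ ()) ∷ []
allCuts (suc n) =
  map (λ S → λ { Fin.zero → false ; (Fin.suc j) → S j }) (allCuts n) ++
  map (λ S → λ { Fin.zero → true  ; (Fin.suc j) → S j }) (allCuts n)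

countE : {m : ℕ} → (Fin m → Bool) → ℕ
countE {m} p = foldr ℕ._+_ 0 (tabulate (λ e → if p e then 1 else 0))

crosses : (G : Graph) → Cut (n G) → Fin (m G) → Bool
crosses G S e = S (proj₁ (edge G e)) xor S (proj₂ (edge G e))

-- a / b as a rational (b = 0 never occurs where used: groups are nonempty)
ratio : ℕ → ℕ → ℚ
ratio a zero    = 0ℚ
ratio a (suc b) = + a / suc b

fE : (G : Graph) → Cut (n G) → ℕ
fE G S = countE (crosses G S)

groupSize : (G : Graph) (Γ : EdgePartition G) → Fin (γ Γ) → ℕ
groupSize G Γ i = countE (λ e → does (group Γ e ≟ i))

fGroup : (G : Graph) (Γ : EdgePartition G) → Cut (n G) → Fin (γ Γ) → ℕ
fGroup G Γ S i = countE (λ e → does (group Γ e ≟ i) ∧ crosses G S e)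

MP : Graph → ℚ
MP G = foldr _⊔_ 0ℚ (map (λ S → ratio (fE G S) (m G)) (allCuts (n G)))

record Dist (n : ℕ) : Set where
  field
    support : List (ℚ × Cut n)
    nonneg  : All (λ p → 0ℚ ≤ proj₁ p) support
    total   : foldr (λ p acc → proj₁ p + acc) 0ℚ support ≡ 1ℚ
open Dist public

expUtil : (G : Graph) (Γ : EdgePartition G) → Dist (n G) → Fin (γ Γ) → ℚ
expUtil G Γ D i =
  foldr (λ p acc → proj₁ p * ratio (fGroup G Γ (proj₂ p) i) (groupSize G Γ i) + acc)
        0ℚ (support D)

-- A uniformly random cut cuts every edge with probability ½, so it gives every group expected
-- utility exactly ½ ≥ MP(G) − ½.  For the converse, put a star with M leaves next to a complete
-- graph K_k and take their two edge sets as the groups.  Cutting off the centre of the star shows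
-- MP(G) ≥ M / (M + |E(K_k)|), close to 1 for large M, while a cut S of K_k cuts
-- |S| (k − |S|) ≤ k² / 4 of its k (k − 1) / 2 edges, so no distribution gives the clique group
-- more than k / (2 (k − 1)), close to ½ for large k.
module Submission where

open import Defs
open import Data.Bool using (Bool; true; false; not; _∧_; _xor_; if_then_else_)
open import Data.Bool.Properties using (xor-comm)
open import Data.Fin using (Fin; zero; suc; toℕ; _↑ˡ_; _↑ʳ_; splitAt; _≟_)
open import Data.Fin.Properties
  using (suc-injective; 0≢1+n; ↑ˡ-injective; ↑ʳ-injective; toℕ-↑ˡ; toℕ-↑ʳ; splitAt-↑ˡ; splitAt-↑ʳ;
         splitAt⁻¹-↑ˡ; splitAt⁻¹-↑ʳ)
open import Data.List using (List; []; _∷_; map; foldr; length; _++_; allFin)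
open import Data.List.Properties
  using (map-++; map-∘; map-cong; length-++; length-map; length-tabulate; map-tabulate; foldr-preservesᵇ)
open import Data.List.Relation.Unary.All using (All; []; _∷_)
import Data.List.Relation.Unary.All as All
import Data.List.Relation.Unary.All.Properties as All
open import Data.List.Relation.Unary.Any using (Any; here; there)
import Data.List.Relation.Unary.Any as Any
import Data.List.Relation.Unary.Any.Properties as Any
open import Data.Nat using (ℕ; zero; suc; NonZero)
open import Data.Nat.ListAction using (sum)
open import Data.Nat.Tactic.RingSolver using (solve-∀)
open import Data.Product using (_×_; Σ; ∃; _,_; proj₁; proj₂)
import Data.Product as Product
open import Data.Sum using (inj₁; inj₂; [_,_]′)
open import Data.Vec.Functional using (Vector) renaming (_++_ to _++ᵥ_)
open import Data.Vec.Functional.Properties using (lookup-++ˡ; lookup-++ʳ)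
open import Data.Vec.Functional.Relation.Unary.All.Properties using (++⁺)
open import Function using (_∘_)
open import Function.Definitions using (Injective)
open import Relation.Binary.PropositionalEquality
open import Relation.Nullary using (contradiction)
open import Relation.Nullary.Decidable using (does; dec-true)

module _ where
  open import Data.Nat using (_+_; _*_; _^_; _≤_; _<_; z≤n; s≤s)
  open import Data.Nat.Properties
    using (+-*-semiring; +-assoc; +-comm; +-suc; +-identityʳ; +-monoʳ-<; *-comm; *-assoc; *-suc;
           *-distribˡ-+; *-monoˡ-≤; *-cancelˡ-≤; ≤-trans; ≤-total; <-irrefl; m≤m+n; m≤n+m;
           m≤n⇒∃[o]m+o≡n; m^n≢0; module ≤-Reasoning)
  open import Algebra.Properties.Semiring.Sum +-*-semiring
    using (sum-cong-≗; ∑-distrib-+; *-distribˡ-sum; *-distribʳ-sum; sum-replicate-zero)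
    renaming (sum to ∑)
  open import Data.Nat.ListAction.Properties using (sum-++)

  -- Counting

  𝟙 : Bool → ℕ
  𝟙 b = if b then 1 else 0

  count : {A : Set} → List A → (A → Bool) → ℕ
  count xs P = sum (map (𝟙 ∘ P) xs)

  count-cong : {A : Set} (xs : List A) {P Q : A → Bool} → P ≗ Q → count xs P ≡ count xs Q
  count-cong xs P≗Q = cong sum (map-cong (cong 𝟙 ∘ P≗Q) xs)

  count-false : {A : Set} (xs : List A) → count xs (λ _ → false) ≡ 0
  count-false []       = refl
  count-false (_ ∷ xs) = count-false xs

  count-+-count-not : {A : Set} (xs : List A) (P : A → Bool) →
                      count xs P + count xs (not ∘ P) ≡ length xs
  count-+-count-not []       P = refl
  count-+-count-not (x ∷ xs) P with P x
  ... | true  = cong suc (count-+-count-not xs P)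
  ... | false = trans (+-suc _ _) (cong suc (count-+-count-not xs P))

  count-map-++-map : {A B : Set} (f g : A → B) (xs : List A) (P : B → Bool) →
                     count (map f xs ++ map g xs) P ≡ count xs (P ∘ f) + count xs (P ∘ g)
  count-map-++-map f g xs P = begin
    sum (map (𝟙 ∘ P) (map f xs ++ map g xs))
      ≡⟨ cong sum (map-++ (𝟙 ∘ P) (map f xs) (map g xs)) ⟩
    sum (map (𝟙 ∘ P) (map f xs) ++ map (𝟙 ∘ P) (map g xs))
      ≡⟨ sum-++ (map (𝟙 ∘ P) (map f xs)) _ ⟩
    sum (map (𝟙 ∘ P) (map f xs)) + sum (map (𝟙 ∘ P) (map g xs))
      ≡⟨ cong₂ _+_ (cong sum (map-∘ xs)) (cong sum (map-∘ xs)) ⟨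
    count xs (P ∘ f) + count xs (P ∘ g) ∎
    where open ≡-Reasoning

  length-map-++-map : {A B : Set} (f g : A → B) (xs : List A) →
                      length (map f xs ++ map g xs) ≡ length xs + length xs
  length-map-++-map f g xs =
    trans (length-++ (map f xs)) (cong₂ _+_ (length-map f xs) (length-map g xs))

  countE≡count : ∀ {m} (p : Fin m → Bool) → countE p ≡ count (allFin m) p
  countE≡count p = cong sum (sym (map-tabulate (λ e → e) (𝟙 ∘ p)))

  countE-cong : ∀ {m} {p q : Fin m → Bool} → p ≗ q → countE p ≡ countE q
  countE-cong {zero}  p≗q = refl
  countE-cong {suc m} p≗q = cong₂ _+_ (cong 𝟙 (p≗q zero)) (countE-cong (p≗q ∘ suc))

  countE-false : ∀ m → countE {m} (λ _ → false) ≡ 0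
  countE-false zero    = refl
  countE-false (suc m) = countE-false m

  countE-true : ∀ m → countE {m} (λ _ → true) ≡ m
  countE-true zero    = refl
  countE-true (suc m) = cong suc (countE-true m)

  countE-+-countE-not : ∀ {m} (p : Fin m → Bool) → countE p + countE (not ∘ p) ≡ m
  countE-+-countE-not {m} p = begin
    countE p + countE (not ∘ p)
      ≡⟨ cong₂ _+_ (countE≡count p) (countE≡count (not ∘ p)) ⟩
    count (allFin m) p + count (allFin m) (not ∘ p)
      ≡⟨ count-+-count-not (allFin m) p ⟩
    length (allFin m)
      ≡⟨ length-tabulate (λ e → e) ⟩
    m ∎
    where open ≡-Reasoning

  countE-≤ : ∀ {m} (p : Fin m → Bool) → countE p ≤ m
  countE-≤ p = subst (countE p ≤_) (countE-+-countE-not p) (m≤m+n _ _)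

  countE-pos : ∀ {m} {p : Fin m → Bool} (e : Fin m) → p e ≡ true → 0 < countE p
  countE-pos         zero    pe rewrite pe = s≤s z≤n
  countE-pos {p = p} (suc e) pe = ≤-trans (countE-pos e pe) (m≤n+m _ (𝟙 (p zero)))

  countE-splitAt : ∀ a {b} (p : Fin (a + b) → Bool) →
                   countE p ≡ countE (p ∘ (_↑ˡ b)) + countE (p ∘ (a ↑ʳ_))
  countE-splitAt zero    p = refl
  countE-splitAt (suc a) p =
    trans (cong (𝟙 (p zero) +_) (countE-splitAt a (p ∘ suc))) (sym (+-assoc (𝟙 (p zero)) _ _))

  countE-++ : ∀ {A : Set} {a b} (h : A → Bool) (xs : Vector A a) (ys : Vector A b) →
              countE (h ∘ (xs ++ᵥ ys)) ≡ countE (h ∘ xs) + countE (h ∘ ys)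
  countE-++ {a = a} h xs ys = trans (countE-splitAt a (h ∘ (xs ++ᵥ ys)))
    (cong₂ _+_ (countE-cong (cong h ∘ lookup-++ˡ xs ys)) (countE-cong (cong h ∘ lookup-++ʳ xs ys)))

  countE≡∑ : ∀ {m} (p : Fin m → Bool) → countE p ≡ ∑ (𝟙 ∘ p)
  countE≡∑ {zero}  p = refl
  countE≡∑ {suc m} p = cong (𝟙 (p zero) +_) (countE≡∑ (p ∘ suc))

  sum-countE-comm : ∀ {A : Set} {m} (xs : List A) (P : A → Fin m → Bool) →
                    sum (map (countE ∘ P) xs) ≡ ∑ (λ e → count xs (λ x → P x e))
  sum-countE-comm {m = m} []       P = sym (sum-replicate-zero m)
  sum-countE-comm         (x ∷ xs) P = begin
    countE (P x) + sum (map (countE ∘ P) xs)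
      ≡⟨ cong₂ _+_ (countE≡∑ (P x)) (sum-countE-comm xs P) ⟩
    ∑ (𝟙 ∘ P x) + ∑ (λ e → count xs (λ y → P y e))
      ≡⟨ ∑-distrib-+ (𝟙 ∘ P x) _ ⟨
    ∑ (λ e → 𝟙 (P x e) + count xs (λ y → P y e)) ∎
    where open ≡-Reasoning

  -- All cuts

  length-allCuts : ∀ n → length (allCuts n) ≡ 2 ^ n
  length-allCuts zero    = refl
  length-allCuts (suc n) = begin
    length (allCuts (suc n))                ≡⟨ length-map-++-map _ _ (allCuts n) ⟩
    length (allCuts n) + length (allCuts n) ≡⟨ cong₂ _+_ (length-allCuts n) (length-allCuts n) ⟩
    2 ^ n + 2 ^ n                           ≡⟨ cong (2 ^ n +_) (+-identityʳ (2 ^ n)) ⟨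
    2 ^ suc n                               ∎
    where open ≡-Reasoning

  allCuts-nonZero : ∀ n → NonZero (length (allCuts n))
  allCuts-nonZero n = subst NonZero (sym (length-allCuts n)) (m^n≢0 2 n)

  allCuts-complete : ∀ {n} (S : Cut n) → Any (_≗ S) (allCuts n)
  allCuts-complete {zero}  S = here (λ ())
  allCuts-complete {suc n} S with S zero in S₀
  ... | false = Any.++⁺ˡ (Any.map⁺ (Any.map (λ S′≗ → λ { zero → sym S₀ ; (suc j) → S′≗ j })
                                            (allCuts-complete (S ∘ suc))))
  ... | true  = Any.++⁺ʳ _ (Any.map⁺ (Any.map (λ S′≗ → λ { zero → sym S₀ ; (suc j) → S′≗ j })
                                              (allCuts-complete (S ∘ suc))))

  -- Split the cuts by the side of the first vertex: if it is u or v, exactly one of the two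
  -- extensions of each cut of the remaining vertices separates u and v; otherwise both or none do.
  separating-cuts : ∀ {n} {u v : Fin n} → u ≢ v →
                    2 * count (allCuts n) (λ S → S u xor S v) ≡ length (allCuts n)
  separating-cuts {suc n} {zero}  {zero}  u≢v = contradiction refl u≢v
  separating-cuts {suc n} {zero}  {suc v} _   = begin
    2 * count (allCuts (suc n)) (λ S → S zero xor S (suc v))
      ≡⟨ cong (2 *_) (count-map-++-map _ _ cuts _) ⟩
    2 * (count cuts (λ S → S v) + count cuts (λ S → not (S v)))
      ≡⟨ cong (2 *_) (count-+-count-not cuts (λ S → S v)) ⟩
    2 * length cuts
      ≡⟨ cong (length cuts +_) (+-identityʳ (length cuts)) ⟩
    length cuts + length cuts
      ≡⟨ length-map-++-map _ _ cuts ⟨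
    length (allCuts (suc n)) ∎
    where
    open ≡-Reasoning
    cuts = allCuts n
  separating-cuts {suc n} {suc u} {zero}  u≢v = begin
    2 * count (allCuts (suc n)) (λ S → S (suc u) xor S zero)
      ≡⟨ cong (2 *_) (count-cong (allCuts (suc n)) (λ S → xor-comm (S (suc u)) (S zero))) ⟩
    2 * count (allCuts (suc n)) (λ S → S zero xor S (suc u))
      ≡⟨ separating-cuts (u≢v ∘ sym) ⟩
    length (allCuts (suc n)) ∎
    where open ≡-Reasoning
  separating-cuts {suc n} {suc u} {suc v} u≢v = begin
    2 * count (allCuts (suc n)) (λ S → S (suc u) xor S (suc v))
      ≡⟨ cong (2 *_) (count-map-++-map _ _ cuts _) ⟩
    2 * (count cuts (λ S → S u xor S v) + count cuts (λ S → S u xor S v))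
      ≡⟨ *-distribˡ-+ 2 (count cuts (λ S → S u xor S v)) _ ⟩
    2 * count cuts (λ S → S u xor S v) + 2 * count cuts (λ S → S u xor S v)
      ≡⟨ cong₂ _+_ half half ⟩
    length cuts + length cuts
      ≡⟨ length-map-++-map _ _ cuts ⟨
    length (allCuts (suc n)) ∎
    where
    open ≡-Reasoning
    cuts = allCuts n
    half = separating-cuts (u≢v ∘ cong suc)

  endpoints-distinct : (G : Graph) (e : Fin (m G)) → proj₁ (edge G e) ≢ proj₂ (edge G e)
  endpoints-distinct G e eq = <-irrefl (cong toℕ eq) (noLoop G e)

  fE-cong : (G : Graph) {S S′ : Cut (n G)} → S ≗ S′ → fE G S ≡ fE G S′
  fE-cong G S≗S′ =
    countE-cong (λ e → cong₂ _xor_ (S≗S′ (proj₁ (edge G e))) (S≗S′ (proj₂ (edge G e))))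

  -- Exchange the two sums: every edge is cut by exactly half of all cuts.
  cut-double-count : (G : Graph) (F : Fin (m G) → Bool) →
    2 * sum (map (λ S → countE (λ e → F e ∧ crosses G S e)) (allCuts (n G)))
      ≡ countE F * length (allCuts (n G))
  cut-double-count G F = begin
    2 * sum (map (λ S → countE (λ e → F e ∧ crosses G S e)) cuts)
      ≡⟨ cong (2 *_) (sum-countE-comm cuts (λ S e → F e ∧ crosses G S e)) ⟩
    2 * ∑ (λ e → count cuts (λ S → F e ∧ crosses G S e))
      ≡⟨ *-distribˡ-sum 2 (λ e → count cuts (λ S → F e ∧ crosses G S e)) ⟩
    ∑ (λ e → 2 * count cuts (λ S → F e ∧ crosses G S e))
      ≡⟨ sum-cong-≗ (λ e → edge-count (F e) e) ⟩
    ∑ (λ e → 𝟙 (F e) * length cuts)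
      ≡⟨ *-distribʳ-sum (length cuts) (𝟙 ∘ F) ⟨
    ∑ (𝟙 ∘ F) * length cuts
      ≡⟨ cong (_* length cuts) (countE≡∑ F) ⟨
    countE F * length cuts ∎
    where
    open ≡-Reasoning
    cuts = allCuts (n G)
    edge-count : ∀ b e → 2 * count cuts (λ S → b ∧ crosses G S e) ≡ 𝟙 b * length cuts
    edge-count false e = cong (2 *_) (count-false cuts)
    edge-count true  e = trans (separating-cuts (endpoints-distinct G e)) (sym (+-identityʳ _))

  -- Graph constructions

  Ascending : ∀ {k} → Fin k × Fin k → Set
  Ascending (u , v) = toℕ u < toℕ v

  relabel-injective : (G : Graph) {k : ℕ} {f : Fin (n G) → Fin k} → Injective _≡_ _≡_ f →
                      Injective _≡_ _≡_ (Product.map f f ∘ edge G)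
  relabel-injective G f-inj eq =
    simple G (cong₂ _,_ (f-inj (cong proj₁ eq)) (f-inj (cong proj₂ eq)))

  ++-injective : ∀ {A : Set} {a b} {xs : Vector A a} {ys : Vector A b} →
                 Injective _≡_ _≡_ xs → Injective _≡_ _≡_ ys → (∀ i j → xs i ≢ ys j) →
                 Injective _≡_ _≡_ (xs ++ᵥ ys)
  ++-injective {a = a} xs-inj ys-inj xs≢ys {i} {j} eq with splitAt a i in i≡ | splitAt a j in j≡
  ... | inj₁ i′ | inj₁ j′ =
    trans (sym (splitAt⁻¹-↑ˡ i≡)) (trans (cong (_↑ˡ _) (xs-inj eq)) (splitAt⁻¹-↑ˡ j≡))
  ... | inj₁ i′ | inj₂ j′ = contradiction eq (xs≢ys i′ j′)
  ... | inj₂ i′ | inj₁ j′ = contradiction (sym eq) (xs≢ys j′ i′)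
  ... | inj₂ i′ | inj₂ j′ =
    trans (sym (splitAt⁻¹-↑ʳ i≡)) (trans (cong (a ↑ʳ_) (ys-inj eq)) (splitAt⁻¹-↑ʳ j≡))

  edgeless : ℕ → Graph
  edgeless k = record { n = k ; m = 0 ; edge = λ () ; noLoop = λ () ; simple = λ { {()} } }

  spokes : ∀ k → Fin k → Fin (suc k) × Fin (suc k)
  spokes k v = zero , suc v

  cone : Graph → Graph
  cone G = record
    { n      = suc (n G)
    ; m      = n G + m G
    ; edge   = spokes (n G) ++ᵥ (Product.map suc suc ∘ edge G)
    ; noLoop = ++⁺ Ascending (λ _ → s≤s z≤n) (s≤s ∘ noLoop G)
    ; simple = ++-injective (suc-injective ∘ cong proj₂) (relabel-injective G suc-injective)
                            (λ _ _ → 0≢1+n ∘ cong proj₁)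
    }

  ↑ˡ-edges : (G : Graph) (k : ℕ) → Fin (m G) → Fin (n G + k) × Fin (n G + k)
  ↑ˡ-edges G k = Product.map (_↑ˡ k) (_↑ˡ k) ∘ edge G

  ↑ʳ-edges : (k : ℕ) (H : Graph) → Fin (m H) → Fin (k + n H) × Fin (k + n H)
  ↑ʳ-edges k H = Product.map (k ↑ʳ_) (k ↑ʳ_) ∘ edge H

  _⊕_ : Graph → Graph → Graph
  G ⊕ H = record
    { n      = n G + n H
    ; m      = m G + m H
    ; edge   = ↑ˡ-edges G (n H) ++ᵥ ↑ʳ-edges (n G) H
    ; noLoop = ++⁺ Ascending (↑ˡ-ascending ∘ noLoop G) (↑ʳ-ascending ∘ noLoop H)
    ; simple = ++-injective (relabel-injective G (↑ˡ-injective (n H) _ _))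
                            (relabel-injective H (↑ʳ-injective (n G) _ _))
                            (λ _ _ → ↑ˡ≢↑ʳ ∘ cong proj₁)
    }
    where
    ↑ˡ-ascending : ∀ {u v : Fin (n G)} → toℕ u < toℕ v → toℕ (u ↑ˡ n H) < toℕ (v ↑ˡ n H)
    ↑ˡ-ascending {u} {v} = subst₂ _<_ (sym (toℕ-↑ˡ u (n H))) (sym (toℕ-↑ˡ v (n H)))
    ↑ʳ-ascending : ∀ {u v : Fin (n H)} → toℕ u < toℕ v → toℕ (n G ↑ʳ u) < toℕ (n G ↑ʳ v)
    ↑ʳ-ascending {u} {v} =
      subst₂ _<_ (sym (toℕ-↑ʳ (n G) u)) (sym (toℕ-↑ʳ (n G) v)) ∘ +-monoʳ-< (n G)
    ↑ˡ≢↑ʳ : ∀ {u v} → u ↑ˡ n H ≢ n G ↑ʳ v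
    ↑ˡ≢↑ʳ {u} {v} eq
      with () ← trans (sym (splitAt-↑ˡ (n G) u (n H)))
                      (trans (cong (splitAt (n G)) eq) (splitAt-↑ʳ (n G) (n H) v))

  fE-cone : (G : Graph) (S : Cut (n (cone G))) →
            fE (cone G) S ≡ countE (λ v → S zero xor S (suc v)) + fE G (S ∘ suc)
  fE-cone G S =
    countE-++ (λ e → S (proj₁ e) xor S (proj₂ e)) (spokes (n G)) (Product.map suc suc ∘ edge G)

  fE-⊕ : (G H : Graph) (S : Cut (n (G ⊕ H))) →
         fE (G ⊕ H) S ≡ fE G (S ∘ (_↑ˡ n H)) + fE H (S ∘ (n G ↑ʳ_))
  fE-⊕ G H S =
    countE-++ (λ e → S (proj₁ e) xor S (proj₂ e)) (↑ˡ-edges G (n H)) (↑ʳ-edges (n G) H)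

  side : ∀ a b → Fin (a + b) → Fin 2
  side a b = _++ᵥ_ {m = a} {n = b} (λ _ → zero) (λ _ → suc zero)

  side-↑ˡ : ∀ {a} b (i : Fin a) → side a b (i ↑ˡ b) ≡ zero
  side-↑ˡ b = lookup-++ˡ (λ _ → zero) (λ _ → suc zero)

  side-↑ʳ : ∀ a {b} (j : Fin b) → side a b (a ↑ʳ j) ≡ suc zero
  side-↑ʳ a = lookup-++ʳ {m = a} (λ _ → zero) (λ _ → suc zero)

  sides : (G H : Graph) → Fin (m G) → Fin (m H) → EdgePartition (G ⊕ H)
  sides G H e₀ e₁ = record
    { γ        = 2
    ; group    = side (m G) (m H)
    ; nonempty = λ { zero       → e₀ ↑ˡ m H , side-↑ˡ (m H) e₀
                   ; (suc zero) → m G ↑ʳ e₁ , side-↑ʳ (m G) e₁ }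
    }

  module _ (G H : Graph) (e₀ : Fin (m G)) (e₁ : Fin (m H)) where
    private
      Γ = sides G H e₀ e₁
      on-right : Fin (m (G ⊕ H)) → Bool
      on-right e = does (group Γ e ≟ suc zero)

    groupSize-right : groupSize (G ⊕ H) Γ (suc zero) ≡ m H
    groupSize-right = begin
      countE on-right
        ≡⟨ countE-splitAt (m G) on-right ⟩
      countE (on-right ∘ (_↑ˡ m H)) + countE (on-right ∘ (m G ↑ʳ_))
        ≡⟨ cong₂ _+_ (countE-cong left) (countE-cong right) ⟩
      countE {m G} (λ _ → false) + countE {m H} (λ _ → true)
        ≡⟨ cong₂ _+_ (countE-false (m G)) (countE-true (m H)) ⟩
      m H ∎
      where
      open ≡-Reasoning
      left : ∀ i → on-right (i ↑ˡ m H) ≡ false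
      left i = cong (λ g → does (g ≟ suc zero)) (side-↑ˡ (m H) i)
      right : ∀ j → on-right (m G ↑ʳ j) ≡ true
      right j = cong (λ g → does (g ≟ suc zero)) (side-↑ʳ (m G) j)

    fGroup-right : ∀ S → fGroup (G ⊕ H) Γ S (suc zero) ≡ fE H (S ∘ (n G ↑ʳ_))
    fGroup-right S = begin
      countE cut-right
        ≡⟨ countE-splitAt (m G) cut-right ⟩
      countE (cut-right ∘ (_↑ˡ m H)) + countE (cut-right ∘ (m G ↑ʳ_))
        ≡⟨ cong₂ _+_ (countE-cong left) (countE-cong right) ⟩
      countE {m G} (λ _ → false) + fE H (S ∘ (n G ↑ʳ_))
        ≡⟨ cong (_+ fE H (S ∘ (n G ↑ʳ_))) (countE-false (m G)) ⟩
      fE H (S ∘ (n G ↑ʳ_)) ∎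
      where
      open ≡-Reasoning
      cut-right : Fin (m (G ⊕ H)) → Bool
      cut-right e = on-right e ∧ crosses (G ⊕ H) S e
      left : ∀ i → cut-right (i ↑ˡ m H) ≡ false
      left i = cong (λ g → does (g ≟ suc zero) ∧ crosses (G ⊕ H) S (i ↑ˡ m H)) (side-↑ˡ (m H) i)
      right : ∀ j → cut-right (m G ↑ʳ j) ≡ crosses H (S ∘ (n G ↑ʳ_)) j
      right j = cong₂ (λ g e → does (g ≟ suc zero) ∧ (S (proj₁ e) xor S (proj₂ e)))
                      (side-↑ʳ (m G) j) (lookup-++ʳ (↑ˡ-edges G (n H)) (↑ʳ-edges (n G) H) j)

  star : ℕ → Graph
  star M = cone (edgeless M)

  apex : ∀ {M k} → Cut (suc M + k)
  apex zero    = true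
  apex (suc _) = false

  fE-star-apex : ∀ M (H : Graph) → fE (star M ⊕ H) (apex {M} {n H}) ≡ M
  fE-star-apex M H = begin
    fE (star M ⊕ H) S
      ≡⟨ fE-⊕ (star M) H S ⟩
    fE (star M) (S ∘ (_↑ˡ n H)) + fE H (λ _ → false)
      ≡⟨ cong₂ _+_ (fE-cone (edgeless M) (S ∘ (_↑ˡ n H))) (countE-false (m H)) ⟩
    countE {M} (λ _ → true) + 0 + 0
      ≡⟨ cong (λ c → c + 0 + 0) (countE-true M) ⟩
    M + 0 + 0
      ≡⟨ trans (+-identityʳ (M + 0)) (+-identityʳ M) ⟩
    M ∎
    where
    open ≡-Reasoning
    S = apex {M} {n H}

  complete : ℕ → Graph
  complete zero    = edgeless zero
  complete (suc k) = cone (complete k)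

  n-complete : ∀ k → n (complete k) ≡ k
  n-complete zero    = refl
  n-complete (suc k) = cong suc (n-complete k)

  2*m-complete : ∀ k → 2 * m (complete (suc k)) ≡ suc k * k
  2*m-complete zero    = refl
  2*m-complete (suc k) = begin
    2 * (n (complete (suc k)) + m (complete (suc k)))
      ≡⟨ *-distribˡ-+ 2 (n (complete (suc k))) _ ⟩
    2 * n (complete (suc k)) + 2 * m (complete (suc k))
      ≡⟨ cong₂ _+_ (cong (2 *_) (n-complete (suc k))) (2*m-complete k) ⟩
    2 * suc k + suc k * k
      ≡⟨ triangular k ⟩
    suc (suc k) * suc k ∎
    where
    open ≡-Reasoning
    triangular : ∀ k → 2 * suc k + suc k * k ≡ suc (suc k) * suc k
    triangular = solve-∀

  fE-complete : ∀ k (S : Cut (n (complete k))) → fE (complete k) S ≡ countE S * countE (not ∘ S)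
  fE-complete zero    S = refl
  fE-complete (suc k) S = begin
    fE (cone (complete k)) S
      ≡⟨ fE-cone (complete k) S ⟩
    countE (λ v → S zero xor S (suc v)) + fE (complete k) (S ∘ suc)
      ≡⟨ cong (countE (λ v → S zero xor S (suc v)) +_) (fE-complete k (S ∘ suc)) ⟩
    countE (λ v → S zero xor S (suc v)) + t * f
      ≡⟨ first-vertex (S zero) ⟩
    (𝟙 (S zero) + t) * (𝟙 (not (S zero)) + f) ∎
    where
    open ≡-Reasoning
    t = countE (S ∘ suc)
    f = countE (not ∘ S ∘ suc)
    first-vertex : ∀ b → countE (λ v → b xor S (suc v)) + t * f ≡ (𝟙 b + t) * (𝟙 (not b) + f)
    first-vertex true  = refl
    first-vertex false = sym (*-suc t f)

  4*ab≤[a+b]² : ∀ a b → 4 * (a * b) ≤ (a + b) * (a + b)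
  4*ab≤[a+b]² a b =
    [ ordered , (λ b≤a → subst₂ (λ x y → 4 * x ≤ y * y) (*-comm b a) (+-comm b a) (ordered b≤a)) ]′
      (≤-total a b)
    where
    ordered : ∀ {a b} → a ≤ b → 4 * (a * b) ≤ (a + b) * (a + b)
    ordered {a} a≤b with d , refl ← m≤n⇒∃[o]m+o≡n a≤b = begin
      4 * (a * (a + d))             ≤⟨ m≤m+n _ (d * d) ⟩
      4 * (a * (a + d)) + d * d     ≡⟨ square-of-sum a d ⟩
      (a + (a + d)) * (a + (a + d)) ∎
      where
      open ≤-Reasoning
      square-of-sum : ∀ a d → 4 * (a * (a + d)) + d * d ≡ (a + (a + d)) * (a + (a + d))
      square-of-sum = solve-∀

  4*fE-complete≤ : ∀ k (S : Cut (n (complete k))) → 4 * fE (complete k) S ≤ k * k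
  4*fE-complete≤ k S = begin
    4 * fE (complete k) S
      ≡⟨ cong (4 *_) (fE-complete k S) ⟩
    4 * (countE S * countE (not ∘ S))
      ≤⟨ 4*ab≤[a+b]² (countE S) (countE (not ∘ S)) ⟩
    (countE S + countE (not ∘ S)) * (countE S + countE (not ∘ S))
      ≡⟨ cong (λ x → x * x) (trans (countE-+-countE-not S) (n-complete k)) ⟩
    k * k ∎
    where open ≤-Reasoning

  complete-cut-bound : ∀ k (S : Cut (n (complete (suc k)))) →
                       fE (complete (suc k)) S * (2 * k) ≤ suc k * m (complete (suc k))
  complete-cut-bound k S = *-cancelˡ-≤ 2 (begin
    2 * (c * (2 * k))    ≡⟨ regroup c k ⟩
    4 * c * k            ≤⟨ *-monoˡ-≤ k (4*fE-complete≤ (suc k) S) ⟩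
    suc k * suc k * k    ≡⟨ *-assoc (suc k) (suc k) k ⟩
    suc k * (suc k * k)  ≡⟨ cong (suc k *_) (2*m-complete k) ⟨
    suc k * (2 * e)      ≡⟨ pull-2 (suc k) e ⟩
    2 * (suc k * e)      ∎)
    where
    open ≤-Reasoning
    c = fE (complete (suc k)) S
    e = m (complete (suc k))
    regroup : ∀ c k → 2 * (c * (2 * k)) ≡ 4 * c * k
    regroup = solve-∀
    pull-2 : ∀ a b → a * (2 * b) ≡ 2 * (a * b)
    pull-2 = solve-∀

open import Data.Integer using (+[1+_]; -[1+_]; +≤+; +<+)
import Data.Integer as ℤ
open import Data.Integer.Properties using (pos-*; pos-+)
import Data.Nat as ℕ
import Data.Nat.Properties as ℕ
open import Data.Rational
  using (ℚ; mkℚ; 0ℚ; 1ℚ; ½; _+_; _-_; _*_; -_; _≤_; _<_; _⊔_; toℚᵘ; *<*; nonNegative)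
open import Data.Rational.Properties
  using (toℚᵘ-fromℚᵘ; fromℚᵘ-cong; toℚᵘ-injective; toℚᵘ-cancel-≤; toℚᵘ-cancel-<; toℚᵘ-homo-+;
         toℚᵘ-homo-*; ↥p/↧p≡p; ≤-reflexive; ≤-trans; <-≤-trans; +-mono-≤; +-monoˡ-≤; +-monoˡ-<;
         *-monoˡ-≤-nonNeg; *-distribʳ-+; *-zeroˡ; *-identityˡ; +-assoc; +-comm; +-identityʳ;
         +-inverseʳ; ⊔-lub; p≤p⊔q; p≤q⊔p; module ≤-Reasoning)
open import Data.Rational.Unnormalised using (mkℚᵘ; *≡*) renaming (_≃_ to _≃ᵘ_)
import Data.Rational.Unnormalised as ℚᵘ
open import Data.Rational.Unnormalised.Properties
  using (≃-sym; module ≃-Reasoning; ≤-respˡ-≃; ≤-respʳ-≃; <-respˡ-≃; <-respʳ-≃)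
  renaming (+-cong to +ᵘ-cong; *-cong to *ᵘ-cong)

-- Fractions

private
  *≡*-ℕ : ∀ {a b c d} → a ℕ.* b ≡ c ℕ.* d → ℤ.+ a ℤ.* ℤ.+ b ≡ ℤ.+ c ℤ.* ℤ.+ d
  *≡*-ℕ {a} {b} {c} {d} eq = trans (sym (pos-* a b)) (trans (cong ℤ.+_ eq) (pos-* c d))

  *≤*-ℕ : ∀ {a b c d} → a ℕ.* b ℕ.≤ c ℕ.* d → ℤ.+ a ℤ.* ℤ.+ b ℤ.≤ ℤ.+ c ℤ.* ℤ.+ d
  *≤*-ℕ {a} {b} {c} {d} le = subst₂ ℤ._≤_ (pos-* a b) (pos-* c d) (+≤+ le)

  *<*-ℕ : ∀ {a b c d} → a ℕ.* b ℕ.< c ℕ.* d → ℤ.+ a ℤ.* ℤ.+ b ℤ.< ℤ.+ c ℤ.* ℤ.+ d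
  *<*-ℕ {a} {b} {c} {d} lt = subst₂ ℤ._<_ (pos-* a b) (pos-* c d) (+<+ lt)

toℚᵘ-ratio : ∀ a b .{{_ : NonZero b}} → toℚᵘ (ratio a b) ≃ᵘ mkℚᵘ (ℤ.+ a) (ℕ.pred b)
toℚᵘ-ratio a (suc b) = toℚᵘ-fromℚᵘ (mkℚᵘ (ℤ.+ a) b)

ratio-cong : ∀ {a b c d} .{{_ : NonZero b}} .{{_ : NonZero d}} →
             a ℕ.* d ≡ c ℕ.* b → ratio a b ≡ ratio c d
ratio-cong {a} {suc b} {c} {suc d} eq =
  fromℚᵘ-cong {mkℚᵘ (ℤ.+ a) b} {mkℚᵘ (ℤ.+ c) d} (*≡* (*≡*-ℕ {a} {suc d} {c} {suc b} eq))

ratio-mono-≤ : ∀ {a b c d} .{{_ : NonZero b}} .{{_ : NonZero d}} →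
               a ℕ.* d ℕ.≤ c ℕ.* b → ratio a b ≤ ratio c d
ratio-mono-≤ {a} {b@(suc _)} {c} {d@(suc _)} le = toℚᵘ-cancel-≤
  (≤-respˡ-≃ (≃-sym (toℚᵘ-ratio a b))
    (≤-respʳ-≃ (≃-sym (toℚᵘ-ratio c d)) (ℚᵘ.*≤* (*≤*-ℕ {a} {d} {c} {b} le))))

ratio-mono-< : ∀ {a b c d} .{{_ : NonZero b}} .{{_ : NonZero d}} →
               a ℕ.* d ℕ.< c ℕ.* b → ratio a b < ratio c d
ratio-mono-< {a} {b@(suc _)} {c} {d@(suc _)} lt = toℚᵘ-cancel-<
  (<-respˡ-≃ (≃-sym (toℚᵘ-ratio a b))
    (<-respʳ-≃ (≃-sym (toℚᵘ-ratio c d)) (ℚᵘ.*<* (*<*-ℕ {a} {d} {c} {b} lt))))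

ratio-+ : ∀ a b c d .{{_ : NonZero b}} .{{_ : NonZero d}} →
          ratio a b + ratio c d ≡ ratio (a ℕ.* d ℕ.+ c ℕ.* b) (b ℕ.* d)
ratio-+ a b@(suc _) c d@(suc _) = toℚᵘ-injective (begin
  toℚᵘ (ratio a b + ratio c d)
    ≈⟨ toℚᵘ-homo-+ (ratio a b) (ratio c d) ⟩
  toℚᵘ (ratio a b) ℚᵘ.+ toℚᵘ (ratio c d)
    ≈⟨ +ᵘ-cong (toℚᵘ-ratio a b) (toℚᵘ-ratio c d) ⟩
  mkℚᵘ (ℤ.+ a) (ℕ.pred b) ℚᵘ.+ mkℚᵘ (ℤ.+ c) (ℕ.pred d)
    ≈⟨ *≡* (cong (ℤ._* ℤ.+ (b ℕ.* d)) numerator) ⟩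
  mkℚᵘ (ℤ.+ (a ℕ.* d ℕ.+ c ℕ.* b)) (ℕ.pred (b ℕ.* d))
    ≈⟨ toℚᵘ-ratio (a ℕ.* d ℕ.+ c ℕ.* b) (b ℕ.* d) ⟨
  toℚᵘ (ratio (a ℕ.* d ℕ.+ c ℕ.* b) (b ℕ.* d)) ∎)
  where
  open ≃-Reasoning
  numerator : ℤ.+ a ℤ.* ℤ.+ d ℤ.+ ℤ.+ c ℤ.* ℤ.+ b ≡ ℤ.+ (a ℕ.* d ℕ.+ c ℕ.* b)
  numerator = sym (trans (pos-+ (a ℕ.* d) (c ℕ.* b)) (cong₂ ℤ._+_ (pos-* a d) (pos-* c b)))

ratio-* : ∀ a b c d .{{_ : NonZero b}} .{{_ : NonZero d}} →
          ratio a b * ratio c d ≡ ratio (a ℕ.* c) (b ℕ.* d)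
ratio-* a b@(suc _) c d@(suc _) = toℚᵘ-injective (begin
  toℚᵘ (ratio a b * ratio c d)
    ≈⟨ toℚᵘ-homo-* (ratio a b) (ratio c d) ⟩
  toℚᵘ (ratio a b) ℚᵘ.* toℚᵘ (ratio c d)
    ≈⟨ *ᵘ-cong (toℚᵘ-ratio a b) (toℚᵘ-ratio c d) ⟩
  mkℚᵘ (ℤ.+ a) (ℕ.pred b) ℚᵘ.* mkℚᵘ (ℤ.+ c) (ℕ.pred d)
    ≈⟨ *≡* (cong (ℤ._* ℤ.+ (b ℕ.* d)) (sym (pos-* a c))) ⟩
  mkℚᵘ (ℤ.+ (a ℕ.* c)) (ℕ.pred (b ℕ.* d))
    ≈⟨ toℚᵘ-ratio (a ℕ.* c) (b ℕ.* d) ⟨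
  toℚᵘ (ratio (a ℕ.* c) (b ℕ.* d)) ∎)
  where open ≃-Reasoning

+-distrib-ratio : ∀ a c d .{{_ : NonZero d}} → ratio (a ℕ.+ c) d ≡ ratio a d + ratio c d
+-distrib-ratio a c d =
  sym (trans (ratio-+ a d c d) (ratio-cong {{ℕ.m*n≢0 d d}} common-denominator))
  where
  common-denominator : (a ℕ.* d ℕ.+ c ℕ.* d) ℕ.* d ≡ (a ℕ.+ c) ℕ.* (d ℕ.* d)
  common-denominator =
    trans (cong (ℕ._* d) (sym (ℕ.*-distribʳ-+ d a c))) (ℕ.*-assoc (a ℕ.+ c) d d)

unit-fraction-below : ∀ {ε} → 0ℚ < ε → ∃ λ p → ratio 1 (suc p) ≤ ε
unit-fraction-below {ε@(mkℚ +[1+ a ] d _)} _ = d , subst (ratio 1 (suc d) ≤_) (↥p/↧p≡p ε)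
  (ratio-mono-≤ {1} {suc d} {suc a} {suc d} (ℕ.*-monoˡ-≤ (suc d) {1} {suc a} (ℕ.s≤s ℕ.z≤n)))
unit-fraction-below {mkℚ (ℤ.+ zero) _ _} (*<* (+<+ ()))
unit-fraction-below {mkℚ -[1+ _ ] _ _} (*<* ())

x+h<y+z⇒x<y-h+z : ∀ {x h y z} → x + h < y + z → x < y - h + z
x+h<y+z⇒x<y-h+z {x} {h} {y} {z} x+h<y+z = begin-strict
  x             ≡⟨ +-identityʳ x ⟨
  x + 0ℚ        ≡⟨ cong (x +_) (+-inverseʳ h) ⟨
  x + (h - h)   ≡⟨ +-assoc x h (- h) ⟨
  x + h - h     <⟨ +-monoˡ-< (- h) x+h<y+z ⟩
  y + z - h     ≡⟨ +-assoc y z (- h) ⟩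
  y + (z - h)   ≡⟨ cong (y +_) (+-comm z (- h)) ⟩
  y + (- h + z) ≡⟨ +-assoc y (- h) z ⟨
  y - h + z     ∎
  where open ≤-Reasoning

-- Distributions over cuts

𝔼 : ∀ {n} → Dist n → (Cut n → ℚ) → ℚ
𝔼 D f = foldr (λ p acc → proj₁ p * f (proj₂ p) + acc) 0ℚ (support D)

𝔼-≤ : ∀ {n} (D : Dist n) {f : Cut n → ℚ} {b : ℚ} → (∀ S → f S ≤ b) → 𝔼 D f ≤ b
𝔼-≤ {n} D {f} {b} f≤b = begin
  𝔼 D f                   ≤⟨ weighted (support D) (nonneg D) ⟩
  weight (support D) * b  ≡⟨ cong (_* b) (total D) ⟩
  1ℚ * b                  ≡⟨ *-identityˡ b ⟩
  b                       ∎
  where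
  open ≤-Reasoning
  weight : List (ℚ × Cut n) → ℚ
  weight = foldr (λ p acc → proj₁ p + acc) 0ℚ
  weighted : ∀ ws → All (λ p → 0ℚ ≤ proj₁ p) ws →
             foldr (λ p acc → proj₁ p * f (proj₂ p) + acc) 0ℚ ws ≤ weight ws * b
  weighted []             []           = ≤-reflexive (sym (*-zeroˡ b))
  weighted ((w , S) ∷ ws) (w≥0 ∷ ws≥0) = begin
    w * f S + foldr (λ p acc → proj₁ p * f (proj₂ p) + acc) 0ℚ ws
      ≤⟨ +-mono-≤ (*-monoˡ-≤-nonNeg w {{nonNegative w≥0}} (f≤b S)) (weighted ws ws≥0) ⟩
    w * b + weight ws * b
      ≡⟨ *-distribʳ-+ b w (weight ws) ⟨
    (w + weight ws) * b ∎

uniform : ∀ {n} (cuts : List (Cut n)) .{{_ : NonZero (length cuts)}} → Dist n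
uniform cuts = record
  { support = map (ratio 1 N ,_) cuts
  ; nonneg  = All.map⁺ (All.universal (λ _ → ratio-mono-≤ {0} {1} {1} {N} ℕ.z≤n) cuts)
  ; total   = trans (weights cuts) (ratio-cong {N} {N} {1} {1} (ℕ.*-comm N 1))
  }
  where
  N = length cuts
  weights : ∀ xs → foldr (λ p acc → proj₁ p + acc) 0ℚ (map (ratio 1 N ,_) xs) ≡ ratio (length xs) N
  weights []       = ratio-cong {0} {1} {0} {N} refl
  weights (_ ∷ xs) = trans (cong (ratio 1 N +_) (weights xs)) (sym (+-distrib-ratio 1 (length xs) N))

𝔼-uniform : ∀ {n} (cuts : List (Cut n)) .{{_ : NonZero (length cuts)}} (f : Cut n → ℕ)
            d .{{_ : NonZero d}} →
            𝔼 (uniform cuts) (λ S → ratio (f S) d) ≡ ratio (sum (map f cuts)) (length cuts ℕ.* d)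
𝔼-uniform cuts f d = go cuts
  where
  N = length cuts
  instance
    N*d≢0 : NonZero (N ℕ.* d)
    N*d≢0 = ℕ.m*n≢0 N d
  go : ∀ xs → foldr (λ p acc → proj₁ p * ratio (f (proj₂ p)) d + acc) 0ℚ (map (ratio 1 N ,_) xs)
              ≡ ratio (sum (map f xs)) (N ℕ.* d)
  go []       = ratio-cong {0} {1} {0} {N ℕ.* d} refl
  go (S ∷ xs) = begin
    ratio 1 N * ratio (f S) d + _
      ≡⟨ cong₂ _+_ (ratio-* 1 N (f S) d) (go xs) ⟩
    ratio (1 ℕ.* f S) (N ℕ.* d) + ratio (sum (map f xs)) (N ℕ.* d)
      ≡⟨ +-distrib-ratio (1 ℕ.* f S) (sum (map f xs)) (N ℕ.* d) ⟨
    ratio (1 ℕ.* f S ℕ.+ sum (map f xs)) (N ℕ.* d)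
      ≡⟨ cong (λ a → ratio (a ℕ.+ sum (map f xs)) (N ℕ.* d)) (ℕ.*-identityˡ (f S)) ⟩
    ratio (f S ℕ.+ sum (map f xs)) (N ℕ.* d) ∎
    where open ≡-Reasoning

ratio-≤-1 : ∀ {a b} → a ℕ.≤ b → ratio a b ≤ 1ℚ
ratio-≤-1 {b = zero}      _   = ratio-mono-≤ {0} {1} {1} {1} ℕ.z≤n
ratio-≤-1 {a} {b@(suc _)} a≤b = ratio-mono-≤ {a} {b} {1} {1}
  (subst₂ ℕ._≤_ (sym (ℕ.*-identityʳ a)) (sym (ℕ.*-identityˡ b)) a≤b)

MP≤1 : (G : Graph) → MP G ≤ 1ℚ
MP≤1 G = foldr-preservesᵇ {P = _≤ 1ℚ} ⊔-lub (ratio-mono-≤ {0} {1} {1} {1} ℕ.z≤n)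
  (All.map⁺ (All.universal (λ S → ratio-≤-1 (countE-≤ (crosses G S))) (allCuts (n G))))

≤-foldr-⊔ : ∀ {x : ℚ} {xs : List ℚ} → Any (x ≤_) xs → x ≤ foldr _⊔_ 0ℚ xs
≤-foldr-⊔ {xs = y ∷ _} (here  x≤y) = ≤-trans x≤y (p≤p⊔q y _)
≤-foldr-⊔ {xs = y ∷ _} (there x≤)  = ≤-trans (≤-foldr-⊔ x≤) (p≤q⊔p y _)

ratio-fE≤MP : (G : Graph) (S : Cut (n G)) → ratio (fE G S) (m G) ≤ MP G
ratio-fE≤MP G S = ≤-foldr-⊔ (Any.map⁺ (Any.map same-value (allCuts-complete S)))
  where
  same-value : ∀ {S′} → S′ ≗ S → ratio (fE G S) (m G) ≤ ratio (fE G S′) (m G)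
  same-value S′≗S = ≤-reflexive (cong (λ c → ratio c (m G)) (fE-cong G (sym ∘ S′≗S)))

groupSize-nonZero : (G : Graph) (Γ : EdgePartition G) (i : Fin (γ Γ)) → NonZero (groupSize G Γ i)
groupSize-nonZero G Γ i = let e , group-e≡i = nonempty Γ i in
  ℕ.>-nonZero (countE-pos e (dec-true (group Γ e ≟ i) group-e≡i))

randomCut : ∀ n → Dist n
randomCut n = uniform (allCuts n) {{allCuts-nonZero n}}

expUtil-randomCut : (G : Graph) (Γ : EdgePartition G) (i : Fin (γ Γ)) →
                    expUtil G Γ (randomCut (n G)) i ≡ ½
expUtil-randomCut G Γ i = begin
  𝔼 (uniform cuts) (λ S → ratio (fGroup G Γ S i) size)
    ≡⟨ 𝔼-uniform cuts (λ S → fGroup G Γ S i) size ⟩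
  ratio (sum (map (λ S → fGroup G Γ S i) cuts)) (length cuts ℕ.* size)
    ≡⟨ ratio-cong {c = 1} {d = 2} half ⟩
  ½ ∎
  where
  open ≡-Reasoning
  cuts = allCuts (n G)
  size = groupSize G Γ i
  instance
    cuts≢0 : NonZero (length cuts)
    cuts≢0 = allCuts-nonZero (n G)
    size≢0 : NonZero size
    size≢0 = groupSize-nonZero G Γ i
    cuts*size≢0 : NonZero (length cuts ℕ.* size)
    cuts*size≢0 = ℕ.m*n≢0 (length cuts) size
  half : sum (map (λ S → fGroup G Γ S i) cuts) ℕ.* 2 ≡ 1 ℕ.* (length cuts ℕ.* size)
  half = begin
    sum (map (λ S → fGroup G Γ S i) cuts) ℕ.* 2
      ≡⟨ ℕ.*-comm (sum (map (λ S → fGroup G Γ S i) cuts)) 2 ⟩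
    2 ℕ.* sum (map (λ S → fGroup G Γ S i) cuts)
      ≡⟨ cut-double-count G (λ e → does (group Γ e ≟ i)) ⟩
    size ℕ.* length cuts
      ≡⟨ ℕ.*-comm size (length cuts) ⟩
    length cuts ℕ.* size
      ≡⟨ ℕ.*-identityˡ (length cuts ℕ.* size) ⟨
    1 ℕ.* (length cuts ℕ.* size) ∎

-- With q = p + 1 and K = K_{q+1}: every cut of K cuts at most the fraction (q + 1) / (2q) of its
-- edges, the star with M = 2q |E(K)| leaves gives MP ≥ 2q / (2q + 1), and
-- (q + 1) / (2q) + ½ < 2q / (2q + 1) + 1 / q.
module _ (p : ℕ) where
  private
    q = suc p
    K = complete (suc q)
    M = 2 ℕ.* q ℕ.* m K

  gap-graph : Graph
  gap-graph = star M ⊕ K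

  gap-partition : EdgePartition gap-graph
  gap-partition = sides (star M) K zero zero

  gap-group-bound : ∀ S → ratio (fGroup gap-graph gap-partition S (suc zero))
                                (groupSize gap-graph gap-partition (suc zero))
                          ≤ ratio (suc q) (2 ℕ.* q)
  gap-group-bound S = begin
    ratio (fGroup gap-graph gap-partition S (suc zero)) (groupSize gap-graph gap-partition (suc zero))
      ≡⟨ cong₂ ratio (fGroup-right (star M) K zero zero S) (groupSize-right (star M) K zero zero) ⟩
    ratio (fE K S′) (m K)
      ≤⟨ ratio-mono-≤ {fE K S′} {m K} {suc q} {2 ℕ.* q} (complete-cut-bound q S′) ⟩
    ratio (suc q) (2 ℕ.* q) ∎
    where
    open ≤-Reasoning
    S′ = S ∘ (n (star M) ↑ʳ_)

  gap-MP : ratio (2 ℕ.* q) (suc (2 ℕ.* q)) ≤ MP gap-graph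
  gap-MP = begin
    ratio (2 ℕ.* q) (suc (2 ℕ.* q))
      ≡⟨ ratio-cong {2 ℕ.* q} {suc (2 ℕ.* q)} {M} {m gap-graph} (cross-multiplied q (m K)) ⟩
    ratio M (m gap-graph)
      ≡⟨ cong (λ c → ratio c (m gap-graph)) (fE-star-apex M K) ⟨
    ratio (fE gap-graph S₀) (m gap-graph)
      ≤⟨ ratio-fE≤MP gap-graph S₀ ⟩
    MP gap-graph ∎
    where
    open ≤-Reasoning
    S₀ = apex {M} {n K}
    cross-multiplied : ∀ q k → 2 ℕ.* q ℕ.* (2 ℕ.* q ℕ.* k ℕ.+ 0 ℕ.+ k) ≡ 2 ℕ.* q ℕ.* k ℕ.* suc (2 ℕ.* q)
    cross-multiplied = solve-∀

  gap-inequality : ratio (suc q) (2 ℕ.* q) + ½ < ratio (2 ℕ.* q) (suc (2 ℕ.* q)) + ratio 1 q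
  gap-inequality = begin-strict
    ratio (suc q) (2 ℕ.* q) + ratio 1 2
      ≡⟨ ratio-+ (suc q) (2 ℕ.* q) 1 2 ⟩
    ratio l (2 ℕ.* q ℕ.* 2)
      <⟨ ratio-mono-< {l} {2 ℕ.* q ℕ.* 2} {r} {rd}
           (subst (l ℕ.* rd ℕ.<_) (cross-multiplied p) (ℕ.m<m+n (l ℕ.* rd) (ℕ.s≤s ℕ.z≤n))) ⟩
    ratio r rd
      ≡⟨ ratio-+ (2 ℕ.* q) (suc (2 ℕ.* q)) 1 q ⟨
    ratio (2 ℕ.* q) (suc (2 ℕ.* q)) + ratio 1 q ∎
    where
    open ≤-Reasoning
    l  = suc q ℕ.* 2 ℕ.+ 1 ℕ.* (2 ℕ.* q)
    r  = 2 ℕ.* q ℕ.* q ℕ.+ 1 ℕ.* suc (2 ℕ.* q)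
    rd = suc (2 ℕ.* q) ℕ.* q
    cross-multiplied :
      ∀ p → (suc (suc p) ℕ.* 2 ℕ.+ 1 ℕ.* (2 ℕ.* suc p)) ℕ.* (suc (2 ℕ.* suc p) ℕ.* suc p) ℕ.+ 2 ℕ.* suc p
            ≡ (2 ℕ.* suc p ℕ.* suc p ℕ.+ 1 ℕ.* suc (2 ℕ.* suc p)) ℕ.* (2 ℕ.* suc p ℕ.* 2)
    cross-multiplied = solve-∀

proposition4p5 :
    ((G : Graph) (Γ : EdgePartition G) →
       Σ (Dist (n G)) λ D → ∀ i → MP G - ½ ≤ expUtil G Γ D i)
    ×
    ((ε : ℚ) → 0ℚ < ε →
       Σ Graph λ G → Σ (EdgePartition G) λ Γ →
         (D : Dist (n G)) → ∃ λ i → expUtil G Γ D i < MP G - ½ + ε)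
proposition4p5 =
  (λ G Γ → randomCut (n G) , λ i → begin
     MP G - ½                        ≤⟨ +-monoˡ-≤ (- ½) (MP≤1 G) ⟩
     ½                               ≡⟨ expUtil-randomCut G Γ i ⟨
     expUtil G Γ (randomCut (n G)) i ∎)
  ,
  (λ ε ε>0 → let p , 1/p+1≤ε = unit-fraction-below ε>0 in
     gap-graph p , gap-partition p , λ D → suc zero , (begin-strict
       expUtil (gap-graph p) (gap-partition p) D (suc zero)
         ≤⟨ 𝔼-≤ D (gap-group-bound p) ⟩
       ratio (2 ℕ.+ p) (2 ℕ.* suc p)
         <⟨ x+h<y+z⇒x<y-h+z {h = ½} {y = MP (gap-graph p)} {z = ε}
              (<-≤-trans (gap-inequality p) (+-mono-≤ (gap-MP p) 1/p+1≤ε)) ⟩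
       MP (gap-graph p) - ½ + ε ∎))
  where open ≤-Reasoning
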